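{- Let $\mathcal{L}_1=(\mathcal{F}_1,\vdash_{\mathcal{L}_1})$ and $\mathcal{L}_2=(\mathcal{F}_2,\vdash_{\mathcal{L}_2})$ be Tarskian logics, where $\mathcal{L}_1$ has a binary conditional connective $\rightarrow$ and satisfies the standard deduction theorem: for all $\mathcal{L}_1$-formulas $\phi_1,\dots,\phi_n,\psi$, $\phi_1,\dots,\phi_n\vdash_{\mathcal{L}_1}\psi$ if and only if $\phi_1,\dots,\phi_{n-1}\vdash_{\mathcal{L}_1}\phi_n\rightarrow\psi$. Let $\mathcal{T}:\mathcal{F}_1\to\mathcal{F}_2$ be a conservative translation that is general-recursive$^C$. Then the image of $\mathcal{L}_1$ under $\mathcal{T}$ has the general deduction theorem: for all $\mathcal{L}_1$-formulas $\phi_1,\dots,\phi_n,\psi$, $$\mathcal{T}(\phi_1),\dots,\mathcal{T}(\phi_n)\vdash_{\mathcal{L}_2}\mathcal{T}(\psi)\quad\text{iff}\quad \mathcal{T}(\phi_1),\dots,\mathcal{T}(\phi_{n-1})\vdash_{\mathcal{L}_2}\alpha^{\rightarrow}(\mathcal{T}(\phi_n),\mathcal{T}(\psi)),$$ where $\alpha^{\rightarrow}(\mathcal{T}(\phi_n),\mathcal{T}(\psi))$ is an $\mathcal{L}_2$-formula containing one or more occurrences of $\mathcal{T}(\phi_n)$ and of $\mathcal{T}(\psi)$ (namely $\alpha^{\rightarrow}(\mathcal{T}(\phi_n),\mathcal{T}(\psi))=\mathcal{T}(\phi_n\rightarrow\psi)$).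
   Context: A Tarskian logic is a pair $(\mathcal{F},\vdash)$ of a set of formulas (built from propositional variables by connectives) and a consequence relation. A translation $\mathcal{T}:\mathcal{F}_1\to\mathcal{F}_2$ is conservative if for every set $\Gamma\cup\{\phi\}\subseteq\mathcal{F}_1$: $\Gamma\vdash_{\mathcal{L}_1}\phi$ iff $\mathcal{T}(\Gamma)\vdash_{\mathcal{L}_2}\mathcal{T}(\phi)$. $\mathcal{T}$ is general-recursive if there are auxiliary mappings $\mathcal{T}'_1,\dots,\mathcal{T}'_w$ (of any arity, defined inductively on $\mathcal{F}_1$-formulas) such that for every $n$-ary connective $\#$ of $\mathcal{L}_1$ and all $\phi_1,\dots,\phi_n\in\mathcal{F}_1$ there is an $\mathcal{L}_2$-formula $\#^{\mathcal{T}}(p_1,\dots,p_m)$ containing only the shown propositional variables with $\mathcal{T}(\#(\phi_1,\dots,\phi_n))=\#^{\mathcal{T}}(\mathcal{T}'_1(\phi_i,\dots,\phi_j)/p_1,\dots,\mathcal{T}'_w(\phi_h,\dots,\phi_l)/p_m)$, where the arguments of the auxiliary mappings are among $\phi_1,\dots,\phi_n$. $\mathcal{T}$ is general-recursive$^C$ if it is general-recursive and compositional for the conditional: there is a template formula $C^{\mathcal{T}}$ of $\mathcal{L}_2$ such that $\mathcal{T}(\phi\rightarrow\psi)=C^{\mathcal{T}}(\mathcal{T}(\phi),\dots,\mathcal{T}(\psi))$, i.e. the translated formula contains as subformulas one or more occurrences of $\mathcal{T}(\phi)$ and $\mathcal{T}(\psi)$ (and no other auxiliary translations of $\phi,\psi$).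 -}

module Defs where

open import Data.Nat using (ℕ; zero; suc; _<_)
open import Data.Fin using (Fin; toℕ) renaming (zero to fzero; suc to fsuc)
open import Data.List using (List; [_]; _++_; map)
open import Data.List.Membership.Propositional using (_∈_)
open import Data.Product using (Σ; ∃; _×_; _,_; proj₁; proj₂)
open import Relation.Binary.PropositionalEquality using (_≡_)
open import Relation.Unary using (Pred; _⊆_; _∪_)
open import Level using (0ℓ)

record Signature : Set₁ where
  field
    Con : ℕ → Set

module _ (Σ' : Signature) where
  open Signature Σ'

  data Form : Set where
    var : ℕ → Form
    con : ∀ {n} → Con n → (Fin n → Form) → Form

module _ {Σ' : Signature} where
  open Signature Σ'

  subst : (ℕ → Form Σ') → Form Σ' → Form Σ'
  subst σ (var i)      = σ i
  subst σ (con c args) = con c (λ j → subst σ (args j))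

  data Occurs (i : ℕ) : Form Σ' → Set where
    here  : Occurs i (var i)
    there : ∀ {n} {c : Con n} {args : Fin n → Form Σ'} (j : Fin n) →
            Occurs i (args j) → Occurs i (con c args)

  data OnlyVars (m : ℕ) : Form Σ' → Set where
    var : ∀ {i} → i < m → OnlyVars m (var i)
    con : ∀ {n} {c : Con n} {args : Fin n → Form Σ'} →
          (∀ j → OnlyVars m (args j)) → OnlyVars m (con c args)

σ₂ : ∀ {Σ'} → Form Σ' → Form Σ' → ℕ → Form Σ'
σ₂ a b zero          = a
σ₂ a b (suc zero)    = b
σ₂ a b (suc (suc i)) = var (suc (suc i))

_⟨_⟩_ : ∀ {Σ'} → Form Σ' → Signature.Con Σ' 2 → Form Σ' → Form Σ'
φ ⟨ imp ⟩ ψ = con imp args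
  where
  args : Fin 2 → Form _
  args fzero    = φ
  args (fsuc _) = ψ

record TarskianLogic : Set₁ where
  field
    sig  : Signature
  F : Set
  F = Form sig
  field
    _⊢_   : Pred F 0ℓ → F → Set
    refl  : ∀ {Γ : Pred F 0ℓ} {φ} → Γ φ → Γ ⊢ φ
    mono  : ∀ {Γ Δ : Pred F 0ℓ} {φ} → Γ ⊆ Δ → Γ ⊢ φ → Δ ⊢ φ
    trans : ∀ {Γ Δ : Pred F 0ℓ} {φ} → (∀ {ψ} → Δ ψ → Γ ⊢ ψ) → Δ ⊢ φ → Γ ⊢ φ

⟦_⟧ : {A : Set} → List A → Pred A 0ℓ
⟦ xs ⟧ x = x ∈ xs

image : {A B : Set} → (A → B) → Pred A 0ℓ → Pred B 0ℓ
image f Γ y = ∃ λ x → Γ x × f x ≡ y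

_⇔_ : Set → Set → Set
A ⇔ B = (A → B) × (B → A)

module _ (L₁ L₂ : TarskianLogic) where
  private
    module L₁ = TarskianLogic L₁
    module L₂ = TarskianLogic L₂
  open Signature (TarskianLogic.sig L₁) renaming (Con to Con₁)

  Translation : Set
  Translation = L₁.F → L₂.F

  Conservative : Translation → Set₁
  Conservative T = ∀ (Γ : Pred L₁.F 0ℓ) φ →
    (Γ L₁.⊢ φ) ⇔ (image T Γ L₂.⊢ T φ)

  record AuxMaps : Set where
    field
      w     : ℕ
      arity : Fin w → ℕ
      map'  : (k : Fin w) → (Fin (arity k) → L₁.F) → L₂.F

  -- general-recursive: for every n-ary connective # and all φ₁..φₙ there is
  -- an L₂-formula #^T(p₀..p_{m-1}) containing only the shown variables and,
  -- for each p_j, an auxiliary mapping T'_k applied to arguments chosen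
  -- among φ₁..φₙ, such that T(#(φ⃗)) = #^T[T'_k(φ…)/p_j].
  GeneralRecursiveWith : Translation → AuxMaps → Set
  GeneralRecursiveWith T A =
    ∀ {n} (c : Con₁ n) (φs : Fin n → L₁.F) →
    Σ ℕ λ m → Σ L₂.F λ tmpl → OnlyVars m tmpl ×
    Σ (Fin m → Σ (Fin w) λ k → Fin (arity k) → Fin n) λ choice →
    Σ (ℕ → L₂.F) λ σ →
      (∀ (j : Fin m) → σ (toℕ j) ≡
         map' (proj₁ (choice j))
              (λ a → φs (proj₂ (choice j) a))) ×
      T (con c φs) ≡ subst σ tmpl
    where open AuxMaps A

  GeneralRecursive : Translation → Set
  GeneralRecursive T = Σ AuxMaps λ A → GeneralRecursiveWith T A

  CompositionalFor : Con₁ 2 → Translation → Set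
  CompositionalFor imp T =
    Σ L₂.F λ C → OnlyVars 2 C × Occurs 0 C × Occurs 1 C ×
      (∀ φ ψ → T (φ ⟨ imp ⟩ ψ) ≡ subst (σ₂ (T φ) (T ψ)) C)

  GeneralRecursiveC : Con₁ 2 → Translation → Set
  GeneralRecursiveC imp T = GeneralRecursive T × CompositionalFor imp T

DeductionTheorem : (L : TarskianLogic) → Signature.Con (TarskianLogic.sig L) 2 → Set
DeductionTheorem L imp = ∀ (Γ : List F) (φₙ ψ : F) →
  (⟦ Γ ++ [ φₙ ] ⟧ ⊢ ψ) ⇔ (⟦ Γ ⟧ ⊢ (φₙ ⟨ imp ⟩ ψ))
  where open TarskianLogic L

module Submission where

-- Proof idea.  The deduction theorem of L₁ transfers to the image of L₁
-- under a conservative translation T by a chain of equivalences: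
--
--   T(Γ), T(φₙ) ⊢₂ T(ψ)  ⇔  Γ, φₙ ⊢₁ ψ          (conservativity)
--                        ⇔  Γ ⊢₁ φₙ → ψ         (deduction theorem of L₁)
--                        ⇔  T(Γ) ⊢₂ T(φₙ → ψ)   (conservativity)
--
-- and compositionality of T for the conditional supplies the template
-- α = C^T with T(φₙ → ψ) = α(T φₙ, T ψ).
--
-- The only bookkeeping concerns the premisses: conservativity speaks of the
-- image of a set, while the theorem lists the translated premisses.

open import Defs
open import Data.List using (List; [_]; _++_; map)
open import Data.List.Membership.Propositional.Properties using (∈-map⁺; ∈-map⁻)
open import Data.Product using (Σ; _×_; _,_; proj₁; proj₂)
open import Relation.Binary.PropositionalEquality using (_≡_; refl; sym)
open import Relation.Unary using (_⊆_)

_⇔-∘_ : {A B C : Set} → A ⇔ B → B ⇔ C → A ⇔ C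
(f , f⁻) ⇔-∘ (g , g⁻) = (λ a → g (f a)) , (λ c → f⁻ (g⁻ c))
infixr 5 _⇔-∘_

⇔-sym : {A B : Set} → A ⇔ B → B ⇔ A
⇔-sym (f , f⁻) = f⁻ , f

⇔-≡ : {A : Set} (P : A → Set) {x y : A} → x ≡ y → P x ⇔ P y
⇔-≡ P refl = (λ p → p) , (λ p → p)

module _ {A B : Set} (f : A → B) (xs : List A) where

  image⊆map : image f ⟦ xs ⟧ ⊆ ⟦ map f xs ⟧
  image⊆map (x , x∈xs , refl) = ∈-map⁺ f x∈xs

  map⊆image : ⟦ map f xs ⟧ ⊆ image f ⟦ xs ⟧
  map⊆image y∈ with ∈-map⁻ f y∈
  ... | x , x∈xs , y≡fx = x , x∈xs , sym y≡fx

⊢-map⇔⊢-image : (L : TarskianLogic) {A : Set} (f : A → TarskianLogic.F L)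
  (xs : List A) (φ : TarskianLogic.F L) →
  TarskianLogic._⊢_ L ⟦ map f xs ⟧ φ ⇔ TarskianLogic._⊢_ L (image f ⟦ xs ⟧) φ
⊢-map⇔⊢-image L f xs φ = mono (map⊆image f xs) , mono (image⊆map f xs)
  where open TarskianLogic L

conservative-list : (L₁ L₂ : TarskianLogic) (T : Translation L₁ L₂) →
  Conservative L₁ L₂ T →
  ∀ (Γ : List (TarskianLogic.F L₁)) φ →
  TarskianLogic._⊢_ L₁ ⟦ Γ ⟧ φ ⇔ TarskianLogic._⊢_ L₂ ⟦ map T Γ ⟧ (T φ)
conservative-list L₁ L₂ T conservative Γ φ =
  conservative ⟦ Γ ⟧ φ ⇔-∘ ⇔-sym (⊢-map⇔⊢-image L₂ T Γ (T φ))

translatedDeduction : (L₁ L₂ : TarskianLogic)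
  (imp : Signature.Con (TarskianLogic.sig L₁) 2) →
  DeductionTheorem L₁ imp →
  (T : Translation L₁ L₂) → Conservative L₁ L₂ T →
  ∀ (Γ : List (TarskianLogic.F L₁)) (φₙ ψ : TarskianLogic.F L₁) →
  TarskianLogic._⊢_ L₂ ⟦ map T (Γ ++ [ φₙ ]) ⟧ (T ψ)
  ⇔ TarskianLogic._⊢_ L₂ ⟦ map T Γ ⟧ (T (φₙ ⟨ imp ⟩ ψ))
translatedDeduction L₁ L₂ imp deduction T conservative Γ φₙ ψ =
  ⇔-sym (conservative-list L₁ L₂ T conservative (Γ ++ [ φₙ ]) ψ)
  ⇔-∘ deduction Γ φₙ ψ
  ⇔-∘ conservative-list L₁ L₂ T conservative Γ (φₙ ⟨ imp ⟩ ψ)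

mainTheorem1 : (L₁ L₂ : TarskianLogic)
    (imp : Signature.Con (TarskianLogic.sig L₁) 2) →
    DeductionTheorem L₁ imp →
    (T : Translation L₁ L₂) →
    Conservative L₁ L₂ T →
    GeneralRecursiveC L₁ L₂ imp T →
    Σ (TarskianLogic.F L₂) λ α →
      OnlyVars 2 α × Occurs 0 α × Occurs 1 α ×
      (∀ (φ ψ : TarskianLogic.F L₁) →
         subst (σ₂ (T φ) (T ψ)) α ≡ T (φ ⟨ imp ⟩ ψ)) ×
      (∀ (Γ : List (TarskianLogic.F L₁)) (φₙ ψ : TarskianLogic.F L₁) →
         (TarskianLogic._⊢_ L₂ ⟦ map T (Γ ++ [ φₙ ]) ⟧ (T ψ))
         ⇔ (TarskianLogic._⊢_ L₂ ⟦ map T Γ ⟧ (subst (σ₂ (T φₙ) (T ψ)) α)))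
mainTheorem1 L₁ L₂ imp deduction T conservative
  (_ , C , onlyVars , occurs₀ , occurs₁ , T-imp≡C) =
  C , onlyVars , occurs₀ , occurs₁ , (λ φ ψ → sym (T-imp≡C φ ψ)) ,
  λ Γ φₙ ψ → translatedDeduction L₁ L₂ imp deduction T conservative Γ φₙ ψ
             ⇔-∘ ⇔-≡ (TarskianLogic._⊢_ L₂ ⟦ map T Γ ⟧) (T-imp≡C φₙ ψ)
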